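{- Let $K \ge 1$ be an integer and let $T$ be a finite rooted tree in which the children of each non-leaf node $v$ are listed in an arbitrary fixed order $v_1, v_2, \ldots, v_{d_v}$. Define $cost(v)$ for all nodes $v$ recursively by $cost(v) = 0$ if $v$ is a leaf, and otherwise $$cost(v) = \sum_{i=1}^{d_v} cost(v_i) + \sum_{i=1}^{d_v - 1} \min\{n_{v_1} + n_{v_2} + \cdots + n_{v_i}, K\}\cdot \min\{n_{v_{i+1}}, K\}.$$ Then for every node $v$: $cost(v) \le n_v^2$ if $n_v \le K$, and $cost(v) \le 2K n_v - K^2$ if $n_v > K$.
   Context: $n_v$ denotes the number of descendants of $v$ in $T$, including $v$ itself; $d_v$ denotes the number of children of $v$. -}

module Defs where

open import Data.Nat using (ℕ; zero; suc; _+_; _*_; _⊓_)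
open import Data.List using (List; []; _∷_)
open import Data.List.Membership.Propositional using (_∈_)

data Tree : Set where
  node : List Tree → Tree

mutual
  size : Tree → ℕ
  size (node cs) = suc (sizes cs)

  sizes : List Tree → ℕ
  sizes [] = 0
  sizes (c ∷ cs) = size c + sizes cs

-- pairTerm K p cs, with p = n_{v_1} + ... + n_{v_i} and cs = v_{i+1}, ..., v_d:
--   Σ_{j=i}^{d-1} min(n_{v_1}+...+n_{v_j}, K) * min(n_{v_{j+1}}, K)
pairTerm : ℕ → ℕ → List Tree → ℕ
pairTerm K p [] = 0
pairTerm K p (c ∷ cs) = (p ⊓ K) * (size c ⊓ K) + pairTerm K (p + size c) cs

crossTerm : ℕ → List Tree → ℕ
crossTerm K [] = 0
crossTerm K (c ∷ cs) = pairTerm K (size c) cs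

mutual
  cost : ℕ → Tree → ℕ
  cost K (node []) = 0
  cost K (node (c ∷ cs)) = costs K (c ∷ cs) + crossTerm K (c ∷ cs)

  costs : ℕ → List Tree → ℕ
  costs K [] = 0
  costs K (c ∷ cs) = cost K c + costs K cs

data NodeOf : Tree → Tree → Set where
  here  : ∀ {t} → NodeOf t t
  there : ∀ {v c cs} → c ∈ cs → NodeOf v c → NodeOf v (node cs)

module Submission where

open import Defs
open import Data.Product using (_×_; _,_)
open import Data.Nat using (ℕ; suc; _+_; _*_; _∸_; _≤_; _>_; _⊓_; _≤?_)
open import Data.Nat.Properties
open import Data.Nat.Tactic.RingSolver using (solve-∀)
open import Data.List using ([]; _∷_)
open import Relation.Binary.PropositionalEquality
open import Relation.Nullary using (yes; no)

-- Call n² − (n ∸ K)² the budget of a subtree of size n: it is n² for n ≤ K and 2Kn − K² for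
-- n > K. A leaf is within budget, and when a prefix of children of total size a is merged with
-- the next child of size b, the budgets of the two parts plus the merging term
-- min(a, K) · min(b, K) stay within the budget of a + b. After expanding (a + b)² this is the
-- merge inequality below, an identity when a, b ≥ K and a consequence of min(a, b) ≤ K otherwise.
-- Adding the root only enlarges the budget.

WithinBudget : ℕ → ℕ → ℕ → Set
WithinBudget K n c = c + (n ∸ K) * (n ∸ K) ≤ n * n

MergeInequality : ℕ → ℕ → ℕ → Set
MergeInequality K a b =
  (a + b ∸ K) * (a + b ∸ K) + (a ⊓ K) * (b ⊓ K) ≤
  2 * (a * b) + (a ∸ K) * (a ∸ K) + (b ∸ K) * (b ∸ K)

data Threshold (K : ℕ) : ℕ → Set where
  below : ∀ {a} → a ≤ K → Threshold K a
  above : ∀ x → Threshold K (K + x)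

threshold : ∀ K a → Threshold K a
threshold K a with a ≤? K
... | yes a≤K = below a≤K
... | no a≰K with m≤n⇒∃[o]m+o≡n (≰⇒≥ a≰K)
...   | x , refl = above x

merge-below-below : ∀ K a b → a ≤ K → b ≤ K → MergeInequality K a b
merge-below-below K a b a≤K b≤K = begin
  e * e + (a ⊓ K) * (b ⊓ K)
    ≡⟨ cong (e * e +_) (cong₂ _*_ (m≤n⇒m⊓n≡m a≤K) (m≤n⇒m⊓n≡m b≤K)) ⟩
  e * e + a * b
    ≤⟨ +-monoˡ-≤ (a * b) (*-mono-≤ e≤a e≤b) ⟩
  a * b + a * b
    ≡⟨ doubling (a * b) ⟩
  2 * (a * b) + 0 * 0 + 0 * 0
    ≡⟨ sym (cong₂ (λ u v → 2 * (a * b) + u * u + v * v) (m≤n⇒m∸n≡0 a≤K) (m≤n⇒m∸n≡0 b≤K)) ⟩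
  2 * (a * b) + (a ∸ K) * (a ∸ K) + (b ∸ K) * (b ∸ K) ∎
  where
  open ≤-Reasoning
  e = a + b ∸ K
  e≤a : e ≤ a
  e≤a = ≤-trans (∸-monoˡ-≤ K (+-monoʳ-≤ a b≤K)) (≤-reflexive (m+n∸n≡m a K))
  e≤b : e ≤ b
  e≤b = ≤-trans (∸-monoˡ-≤ K (+-monoˡ-≤ b a≤K)) (≤-reflexive (m+n∸m≡n K b))
  doubling : ∀ m → m + m ≡ 2 * m + 0 * 0 + 0 * 0
  doubling = solve-∀

merge-above-below : ∀ K x b → b ≤ K → MergeInequality K (K + x) b
merge-above-below K x b b≤K = begin
  (K + x + b ∸ K) * (K + x + b ∸ K) + ((K + x) ⊓ K) * (b ⊓ K)
    ≡⟨ cong₂ (λ u v → u * u + v) excess (cong₂ _*_ (m≥n⇒m⊓n≡n (m≤m+n K x)) (m≤n⇒m⊓n≡m b≤K)) ⟩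
  (x + b) * (x + b) + K * b
    ≡⟨ expand K x b ⟩
  (x * x + 2 * (x * b) + K * b) + b * b
    ≤⟨ +-monoʳ-≤ _ (*-monoˡ-≤ b b≤K) ⟩
  (x * x + 2 * (x * b) + K * b) + K * b
    ≡⟨ collect K x b ⟩
  2 * ((K + x) * b) + x * x + 0 * 0
    ≡⟨ sym (cong₂ (λ u v → 2 * ((K + x) * b) + u * u + v * v) (m+n∸m≡n K x) (m≤n⇒m∸n≡0 b≤K)) ⟩
  2 * ((K + x) * b) + (K + x ∸ K) * (K + x ∸ K) + (b ∸ K) * (b ∸ K) ∎
  where
  open ≤-Reasoning
  excess : K + x + b ∸ K ≡ x + b
  excess = trans (cong (_∸ K) (+-assoc K x b)) (m+n∸m≡n K (x + b))
  expand : ∀ K x b → (x + b) * (x + b) + K * b ≡ (x * x + 2 * (x * b) + K * b) + b * b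
  expand = solve-∀
  collect : ∀ K x b → (x * x + 2 * (x * b) + K * b) + K * b ≡ 2 * ((K + x) * b) + x * x + 0 * 0
  collect = solve-∀

merge-above-above : ∀ K x y → MergeInequality K (K + x) (K + y)
merge-above-above K x y = ≤-reflexive (begin
  (K + x + (K + y) ∸ K) * (K + x + (K + y) ∸ K) + ((K + x) ⊓ K) * ((K + y) ⊓ K)
    ≡⟨ cong₂ (λ u v → u * u + v) excess (cong₂ _*_ (m≥n⇒m⊓n≡n (m≤m+n K x)) (m≥n⇒m⊓n≡n (m≤m+n K y))) ⟩
  (K + x + y) * (K + x + y) + K * K
    ≡⟨ identity K x y ⟩
  2 * ((K + x) * (K + y)) + x * x + y * y
    ≡⟨ sym (cong₂ (λ u v → 2 * ((K + x) * (K + y)) + u * u + v * v) (m+n∸m≡n K x) (m+n∸m≡n K y)) ⟩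
  2 * ((K + x) * (K + y)) + (K + x ∸ K) * (K + x ∸ K) + (K + y ∸ K) * (K + y ∸ K) ∎)
  where
  open ≡-Reasoning
  excess : K + x + (K + y) ∸ K ≡ K + x + y
  excess = trans (cong (_∸ K) (shuffle K x y)) (m+n∸m≡n K (K + x + y))
    where
    shuffle : ∀ K x y → K + x + (K + y) ≡ K + (K + x + y)
    shuffle = solve-∀
  identity : ∀ K x y → (K + x + y) * (K + x + y) + K * K ≡ 2 * ((K + x) * (K + y)) + x * x + y * y
  identity = solve-∀

MergeInequality-sym : ∀ K a b → MergeInequality K a b → MergeInequality K b a
MergeInequality-sym K a b = subst₂ _≤_
  (cong₂ (λ s t → (s ∸ K) * (s ∸ K) + t) (+-comm a b) (*-comm (a ⊓ K) (b ⊓ K)))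
  (trans (cong (λ m → 2 * m + ea + eb) (*-comm a b)) (exchange (2 * (b * a)) ea eb))
  where
  ea = (a ∸ K) * (a ∸ K)
  eb = (b ∸ K) * (b ∸ K)
  exchange : ∀ m u v → m + u + v ≡ m + v + u
  exchange = solve-∀

merge-inequality : ∀ K a b → MergeInequality K a b
merge-inequality K a b with threshold K a | threshold K b
... | below a≤K | below b≤K = merge-below-below K a b a≤K b≤K
... | above x   | below b≤K = merge-above-below K x b b≤K
... | below a≤K | above y   = MergeInequality-sym K (K + y) a (merge-above-below K y a a≤K)
... | above x   | above y   = merge-above-above K x y

WithinBudget-merge : ∀ K a b {ca cb} → WithinBudget K a ca → WithinBudget K b cb →
                     WithinBudget K (a + b) (ca + cb + (a ⊓ K) * (b ⊓ K))
WithinBudget-merge K a b {ca} {cb} ga gb = +-cancelʳ-≤ (ea + eb) _ _ (begin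
  ca + cb + m + e + (ea + eb)        ≡⟨ regroup ca cb m e ea eb ⟩
  (ca + ea) + (cb + eb) + (e + m)    ≤⟨ +-mono-≤ (+-mono-≤ ga gb) (merge-inequality K a b) ⟩
  a * a + b * b + (2 * (a * b) + ea + eb) ≡⟨ square-sum a b ea eb ⟩
  (a + b) * (a + b) + (ea + eb)      ∎)
  where
  open ≤-Reasoning
  m = (a ⊓ K) * (b ⊓ K)
  e = (a + b ∸ K) * (a + b ∸ K)
  ea = (a ∸ K) * (a ∸ K)
  eb = (b ∸ K) * (b ∸ K)
  regroup : ∀ ca cb m e ea eb → ca + cb + m + e + (ea + eb) ≡ (ca + ea) + (cb + eb) + (e + m)
  regroup = solve-∀
  square-sum : ∀ a b ea eb → a * a + b * b + (2 * (a * b) + ea + eb) ≡ (a + b) * (a + b) + (ea + eb)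
  square-sum = solve-∀

WithinBudget-antitone : ∀ K n {c c′} → c ≤ c′ → WithinBudget K n c′ → WithinBudget K n c
WithinBudget-antitone K n c≤c′ = ≤-trans (+-monoˡ-≤ _ c≤c′)

WithinBudget-leaf : ∀ K → WithinBudget K 1 0
WithinBudget-leaf K = *-mono-≤ (m∸n≤m 1 K) (m∸n≤m 1 K)

-- The root is a one-node tree merged in at no cost.
WithinBudget-suc : ∀ K n {c} → WithinBudget K n c → WithinBudget K (suc n) c
WithinBudget-suc K n {c} g = subst (λ s → WithinBudget K s c) (+-comm n 1)
  (WithinBudget-antitone K (n + 1) (≤-trans (m≤m+n c 0) (m≤m+n _ _))
    (WithinBudget-merge K n 1 g (WithinBudget-leaf K)))

mutual
  cost-WithinBudget : ∀ K t → WithinBudget K (size t) (cost K t)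
  cost-WithinBudget K (node [])       = WithinBudget-leaf K
  cost-WithinBudget K (node (c ∷ cs)) =
    WithinBudget-suc K (size c + sizes cs) (children-WithinBudget K cs (cost-WithinBudget K c))

  children-WithinBudget : ∀ K cs {p cp} → WithinBudget K p cp →
                          WithinBudget K (p + sizes cs) (cp + costs K cs + pairTerm K p cs)
  children-WithinBudget K [] {p} {cp} g =
    subst₂ (WithinBudget K) (sym (+-identityʳ p))
      (sym (trans (+-identityʳ (cp + 0)) (+-identityʳ cp))) g
  children-WithinBudget K (c ∷ cs) {p} {cp} g =
    subst₂ (WithinBudget K) (+-assoc p (size c) (sizes cs)) (regroup cp (cost K c) (costs K cs) _ _)
      (children-WithinBudget K cs (WithinBudget-merge K p (size c) g (cost-WithinBudget K c)))
    where
    regroup : ∀ a b c d e → a + b + d + c + e ≡ a + (b + c) + (d + e)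
    regroup = solve-∀

WithinBudget⇒≤square : ∀ K n {c} → WithinBudget K n c → c ≤ n * n
WithinBudget⇒≤square K n {c} = ≤-trans (m≤m+n c _)

WithinBudget⇒≤linear : ∀ K n {c} → n > K → WithinBudget K n c → c ≤ 2 * K * n ∸ K * K
WithinBudget⇒≤linear K n {c} n>K g with m≤n⇒∃[o]m+o≡n (<⇒≤ n>K)
... | x , refl = +-cancelʳ-≤ (x * x) c _
  (subst₂ (λ e s → c + e * e ≤ s) (m+n∸m≡n K x) (square-split K x) g)
  where
  square-split : ∀ K x → (K + x) * (K + x) ≡ (2 * K * (K + x) ∸ K * K) + x * x
  square-split K x = begin
    (K + x) * (K + x)                         ≡⟨ expand K x ⟩
    K * K + 2 * K * x + x * x                 ≡⟨ cong (_+ x * x) (sym (m+n∸m≡n (K * K) (K * K + 2 * K * x))) ⟩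
    (K * K + (K * K + 2 * K * x) ∸ K * K) + x * x ≡⟨ cong (λ s → (s ∸ K * K) + x * x) (collect K x) ⟩
    (2 * K * (K + x) ∸ K * K) + x * x         ∎
    where
    open ≡-Reasoning
    expand : ∀ K x → (K + x) * (K + x) ≡ K * K + 2 * K * x + x * x
    expand = solve-∀
    collect : ∀ K x → K * K + (K * K + 2 * K * x) ≡ 2 * K * (K + x)
    collect = solve-∀

lemma4 : (K : ℕ) → 1 ≤ K → (T v : Tree) → NodeOf v T →
    (size v ≤ K → cost K v ≤ size v * size v) ×
    (size v > K → cost K v ≤ 2 * K * size v ∸ K * K)
lemma4 K _ _ v _ =
  (λ _ → WithinBudget⇒≤square K (size v) budget) ,
  (λ v>K → WithinBudget⇒≤linear K (size v) v>K budget)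
  where
  budget : WithinBudget K (size v) (cost K v)
  budget = cost-WithinBudget K v
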